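{- The sequence $$\Big((-1)^{s_4(x)}\Big(S_{5,0}(x)-10S_{5,0}\big(16\lfloor x/256\rfloor\big)+5S_{5,0}\big(\lfloor x/256\rfloor\big)\Big)\Big)_{x\ge 0}$$ is periodic with period $2560$.
   Context: For an integer $b\ge 2$ and integer $r\ge 0$, $s_b(r)$ denotes the sum of the digits of $r$ in base $b$. For integers $x\ge 0$, define $$S_{5,0}(x)=\sum_{0\le r<x,\; r\equiv 0 \pmod 5}(-1)^{s_{4}(r)}.$$ -}

module Defs where

open import Data.Nat using (ℕ; zero; suc; _+_; _*_; _%_; _/_; _≡ᵇ_)
open import Data.Integer as ℤ using (ℤ; +_; -_)
open import Data.Bool using (if_then_else_)

-- digit sum of r in base (suc (suc k)), i.e. base b = k + 2 ≥ 2.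
-- Fuel argument: r itself suffices since r / b < r for r > 0.
digitSumAux : ℕ → ℕ → ℕ → ℕ
digitSumAux fuel      k zero    = 0
digitSumAux zero      k (suc r) = 0
digitSumAux (suc f)   k (suc r) = (suc r % suc (suc k)) + digitSumAux f k (suc r / suc (suc k))

s : (b-2 : ℕ) → ℕ → ℕ
s k r = digitSumAux r k r

s₄ : ℕ → ℕ
s₄ = s 2

sign : ℕ → ℤ
sign n = if n % 2 ≡ᵇ 0 then + 1 else - (+ 1)

S₅₀ : ℕ → ℤ
S₅₀ zero    = + 0
S₅₀ (suc x) = S₅₀ x ℤ.+ (if x % 5 ≡ᵇ 0 then sign (s₄ x) else + 0)

u : ℕ → ℤ
u x = sign (s₄ x) ℤ.* (S₅₀ x ℤ.- (+ 10) ℤ.* S₅₀ (16 * (x / 256)) ℤ.+ (+ 5) ℤ.* S₅₀ (x / 256))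

module Submission where

-- Write t r = (-1)^{s₄(r)} and x = b + 256·a with b < 256.
--  * Digit sums split along base-b blocks: s(m + a·bⁿ) = s(m) + s(a) for
--    m < bⁿ, hence t(m + a·4ᵏ) = t(m)·t(a).
--  * Since 4ᵏ ≡ 1 (mod 5) for even k, the part of S₅₀ coming from the block
--    [a·4ᵏ, a·4ᵏ + b) equals t(a)·P_{a mod 5}(b), where P_j(b) is the sum of
--    t(r) over r < b with j + r ≡ 0 (mod 5).
--  * Applying this to k = 4, k = 2 and k = 0 and evaluating the constants
--    P_j(256) − 10·P_j(16) + 5·P_j(1) = 1 (for each j < 5) gives
--    S₅₀(256a) − 10·S₅₀(16a) + 5·S₅₀(a) = T(a) := Σ_{r<a} t(r).
--  * The Thue–Morse-like sum T(a) vanishes at even a, so T(a) = t(a)·e(a) with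
--    e(a) = 0 for even a and −1 for odd a.
--  * Combining, u(b + 256a) = t(b)·(e(a) + P_{a mod 5}(b)), which depends on a
--    only through a mod 10; this is periodicity with period 10·256 = 2560.

open import Defs
open import Data.Nat using (ℕ; _+_)
open import Relation.Binary.PropositionalEquality using (_≡_)

open import Data.Nat using (zero; suc; _*_; _%_; _/_; _≡ᵇ_; _^_; _≤_; _<_; z≤n; s≤s; s≤s⁻¹; NonZero)
open import Data.Nat.Properties
open import Data.Nat.DivMod
open import Data.Nat.Divisibility using (n∣m*n)
open import Data.Integer as ℤ using (ℤ; +_; -_)
import Data.Integer.Properties as ℤP
open import Data.Bool using (Bool; true; false; if_then_else_)
open import Data.Product using (∃; _,_)
open import Data.Sum using (_⊎_; inj₁; inj₂)
open import Relation.Binary.PropositionalEquality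
  using (refl; sym; trans; cong; cong₂; subst; module ≡-Reasoning)
import Data.Nat.Tactic.RingSolver as ℕ-Solver
import Data.Integer.Tactic.RingSolver as ℤ-Solver

mod-low : ∀ {n} .{{_ : NonZero n}} d q → d < n → (d + q * n) % n ≡ d
mod-low d q d<n = trans ([m+kn]%n≡m%n d q _) (m<n⇒m%n≡m d<n)

div-low : ∀ {n} .{{_ : NonZero n}} d q → d < n → (d + q * n) / n ≡ q
div-low {n} d q d<n = begin
    (d + q * n) / n     ≡⟨ +-distrib-/-∣ʳ d (n∣m*n q) ⟩
    d / n + q * n / n   ≡⟨ cong₂ _+_ (m<n⇒m/n≡0 d<n) (m*n/n≡m q n) ⟩
    q                   ∎
  where open ≡-Reasoning

-- Digit sums in base b = k + 2.  Dividing by b strictly decreases a positive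
-- number, so the fuel of digitSumAux is irrelevant once it bounds the
-- argument; this yields the defining recursion of s.
quotient≤pred : ∀ k r → suc r / suc (suc k) ≤ r
quotient≤pred k r = s≤s⁻¹ (m/n<m (suc r) (suc (suc k)) (s≤s (s≤s z≤n)))

digitSumAux-fuel : ∀ k f g r → r ≤ f → r ≤ g → digitSumAux f k r ≡ digitSumAux g k r
digitSumAux-fuel k f g zero _ _ = refl
digitSumAux-fuel k (suc f) (suc g) (suc r) (s≤s r≤f) (s≤s r≤g) =
  cong (_+_ (suc r % suc (suc k)))
       (digitSumAux-fuel k f g (suc r / suc (suc k))
          (≤-trans (quotient≤pred k r) r≤f) (≤-trans (quotient≤pred k r) r≤g))

digitSum-step : ∀ k r → s k r ≡ r % suc (suc k) + s k (r / suc (suc k))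
digitSum-step k zero = refl
digitSum-step k (suc r) =
  cong (_+_ (suc r % suc (suc k)))
       (digitSumAux-fuel k r (suc r / suc (suc k)) _ (quotient≤pred k r) ≤-refl)

digitSum-digit : ∀ k d q → d < suc (suc k) → s k (d + q * suc (suc k)) ≡ d + s k q
digitSum-digit k d q d<b =
  trans (digitSum-step k (d + q * b)) (cong₂ (λ x y → x + s k y) (mod-low d q d<b) (div-low d q d<b))
  where b = suc (suc k)

digitSum-concat : ∀ k n a m → m < suc (suc k) ^ n → s k (m + a * suc (suc k) ^ n) ≡ s k m + s k a
digitSum-concat k zero a zero _ = cong (s k) (*-identityʳ a)
digitSum-concat k zero a (suc m) (s≤s ())
digitSum-concat k (suc n) a m m<bⁿ⁺¹ = begin
    s k (m + a * b ^ suc n)              ≡⟨ cong (λ z → s k (z + a * b ^ suc n)) m≡ ⟩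
    s k ((d + m' * b) + a * (b * b ^ n)) ≡⟨ cong (s k) (regroup d m' a b (b ^ n)) ⟩
    s k (d + (m' + a * b ^ n) * b)       ≡⟨ digitSum-digit k d (m' + a * b ^ n) d<b ⟩
    d + s k (m' + a * b ^ n)             ≡⟨ cong (_+_ d) (digitSum-concat k n a m' m'<bⁿ) ⟩
    d + (s k m' + s k a)                 ≡⟨ +-assoc d (s k m') (s k a) ⟨
    (d + s k m') + s k a                 ≡⟨ cong (_+ s k a) (digitSum-digit k d m' d<b) ⟨
    s k (d + m' * b) + s k a             ≡⟨ cong (λ z → s k z + s k a) m≡ ⟨
    s k m + s k a                        ∎
  where
  open ≡-Reasoning
  b  = suc (suc k)
  d  = m % b
  m' = m / b
  m≡ : m ≡ d + m' * b
  m≡ = m≡m%n+[m/n]*n m b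
  d<b : d < b
  d<b = m%n<n m b
  m'<bⁿ : m' < b ^ n
  m'<bⁿ = m<n*o⇒m/o<n (subst (m <_) (*-comm b (b ^ n)) m<bⁿ⁺¹)
  regroup : ∀ d m' a b p → (d + m' * b) + a * (b * p) ≡ d + (m' + a * p) * b
  regroup = ℕ-Solver.solve-∀

sign-suc : ∀ n → sign (suc n) ≡ - sign n
sign-suc zero = refl
sign-suc (suc zero) = refl
sign-suc (suc (suc n)) = sign-suc n

sign-+ : ∀ m n → sign (m + n) ≡ sign m ℤ.* sign n
sign-+ zero n = sym (ℤP.*-identityˡ (sign n))
sign-+ (suc zero) n = trans (sign-suc n) (sym (ℤP.-1*i≡-i (sign n)))
sign-+ (suc (suc m)) n = sign-+ m n

sign-square : ∀ n → sign n ℤ.* sign n ≡ + 1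
sign-square zero = refl
sign-square (suc zero) = refl
sign-square (suc (suc n)) = sign-square n

t : ℕ → ℤ
t r = sign (s₄ r)

t-concat : ∀ k a m → m < 4 ^ k → t (m + a * 4 ^ k) ≡ t m ℤ.* t a
t-concat k a m m<4ᵏ = trans (cong sign (digitSum-concat 2 k a m m<4ᵏ)) (sign-+ (s₄ m) (s₄ a))

t-flip : ∀ c → t (suc (c * 2)) ≡ - t (c * 2)
t-flip c = trans (cong sign s₄-suc) (sign-suc (s₄ (c * 2)))
  where
  open ≡-Reasoning
  d = (c % 2) * 2
  q = c / 2
  c*2≡ : c * 2 ≡ d + q * 4
  c*2≡ = trans (cong (_* 2) (m≡m%n+[m/n]*n c 2)) (double (c % 2) q)
    where
    double : ∀ r q → (r + q * 2) * 2 ≡ r * 2 + q * 4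
    double = ℕ-Solver.solve-∀
  d≤2 : d ≤ 2
  d≤2 = *-monoˡ-≤ 2 (s≤s⁻¹ (m%n<n c 2))
  s₄-suc : s₄ (suc (c * 2)) ≡ suc (s₄ (c * 2))
  s₄-suc = begin
    s₄ (suc (c * 2))       ≡⟨ cong (λ z → s₄ (suc z)) c*2≡ ⟩
    s₄ (suc d + q * 4)     ≡⟨ digitSum-digit 2 (suc d) q (s≤s (s≤s d≤2)) ⟩
    suc (d + s₄ q)         ≡⟨ cong suc (digitSum-digit 2 d q (s≤s (≤-trans d≤2 (n≤1+n 2)))) ⟨
    suc (s₄ (d + q * 4))   ≡⟨ cong (λ z → suc (s₄ z)) c*2≡ ⟨
    suc (s₄ (c * 2))       ∎

T : ℕ → ℤ
T zero = + 0
T (suc a) = T a ℤ.+ t a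

P : ℕ → ℕ → ℤ
P j zero = + 0
P j (suc b) = P j b ℤ.+ (if (j + b) % 5 ≡ᵇ 0 then t b else + 0)

e : ℕ → ℤ
e zero = + 0
e (suc zero) = - (+ 1)
e (suc (suc a)) = e a

even-or-odd : ∀ a → ∃ (λ c → a ≡ c * 2) ⊎ ∃ (λ c → a ≡ suc (c * 2))
even-or-odd zero = inj₁ (0 , refl)
even-or-odd (suc a) with even-or-odd a
... | inj₁ (c , a≡) = inj₂ (c , cong suc a≡)
... | inj₂ (c , a≡) = inj₁ (suc c , cong suc a≡)

-- Consecutive pairs (2c, 2c+1) cancel, so T vanishes at even arguments.
T-even : ∀ c → T (c * 2) ≡ + 0
T-even zero = refl
T-even (suc c) = begin
    (T (c * 2) ℤ.+ t (c * 2)) ℤ.+ t (suc (c * 2))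
      ≡⟨ cong₂ (λ x y → (x ℤ.+ t (c * 2)) ℤ.+ y) (T-even c) (t-flip c) ⟩
    (+ 0 ℤ.+ t (c * 2)) ℤ.+ - t (c * 2)
      ≡⟨ cong (ℤ._+ - t (c * 2)) (ℤP.+-identityˡ (t (c * 2))) ⟩
    t (c * 2) ℤ.+ - t (c * 2)
      ≡⟨ ℤP.+-inverseʳ (t (c * 2)) ⟩
    + 0 ∎
  where open ≡-Reasoning

-- Closed form of T: 0 at even a, and at odd a = 2c + 1 it is t(2c) = −t(a).
T≡t*e : ∀ a → T a ≡ t a ℤ.* e a
T≡t*e a with even-or-odd a
... | inj₁ (c , refl) =
  trans (T-even c) (sym (trans (cong (t (c * 2) ℤ.*_) (e-even c)) (ℤP.*-zeroʳ (t (c * 2)))))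
  where
  e-even : ∀ c → e (c * 2) ≡ + 0
  e-even zero = refl
  e-even (suc c) = e-even c
... | inj₂ (c , refl) = begin
    T (c * 2) ℤ.+ t (c * 2)               ≡⟨ cong (ℤ._+ t (c * 2)) (T-even c) ⟩
    + 0 ℤ.+ t (c * 2)                     ≡⟨ negate-twice (t (c * 2)) ⟩
    (- t (c * 2)) ℤ.* - (+ 1)             ≡⟨ cong₂ ℤ._*_ (t-flip c) (e-odd c) ⟨
    t (suc (c * 2)) ℤ.* e (suc (c * 2))   ∎
  where
  open ≡-Reasoning
  e-odd : ∀ c → e (suc (c * 2)) ≡ - (+ 1)
  e-odd zero = refl
  e-odd (suc c) = e-odd c
  negate-twice : ∀ x → + 0 ℤ.+ x ≡ (- x) ℤ.* - (+ 1)
  negate-twice = ℤ-Solver.solve-∀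

mod5-shift : ∀ N a b → N % 5 ≡ 1 → (b + a * N) % 5 ≡ (a % 5 + b) % 5
mod5-shift N a b N≡1 = begin
    (b + a * N) % 5            ≡⟨ %-distribˡ-+ b (a * N) 5 ⟩
    (b % 5 + (a * N) % 5) % 5  ≡⟨ cong (λ z → (b % 5 + z) % 5) aN≡a ⟩
    (b % 5 + a % 5 % 5) % 5    ≡⟨ cong (_% 5) (+-comm (b % 5) (a % 5 % 5)) ⟩
    (a % 5 % 5 + b % 5) % 5    ≡⟨ %-distribˡ-+ (a % 5) b 5 ⟨
    (a % 5 + b) % 5            ∎
  where
  open ≡-Reasoning
  aN≡a : (a * N) % 5 ≡ a % 5 % 5
  aN≡a = trans (%-distribˡ-* a N 5)
         (trans (cong (λ z → ((a % 5) * z) % 5) N≡1) (cong (_% 5) (*-identityʳ (a % 5))))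

S₅₀-block : ∀ k a b → 4 ^ k % 5 ≡ 1 → b ≤ 4 ^ k →
            S₅₀ (b + a * 4 ^ k) ≡ S₅₀ (a * 4 ^ k) ℤ.+ t a ℤ.* P (a % 5) b
S₅₀-block k a zero _ _ = sym (trans (cong (ℤ._+_ (S₅₀ (a * 4 ^ k))) (ℤP.*-zeroʳ (t a))) (ℤP.+-identityʳ _))
S₅₀-block k a (suc b) N≡1 b<N = begin
    S₅₀ (b + a * N) ℤ.+ term
      ≡⟨ cong₂ ℤ._+_ (S₅₀-block k a b N≡1 (<⇒≤ b<N)) term≡ ⟩
    (S₅₀ (a * N) ℤ.+ t a ℤ.* P j b) ℤ.+ t a ℤ.* term'
      ≡⟨ ℤP.+-assoc (S₅₀ (a * N)) _ _ ⟩
    S₅₀ (a * N) ℤ.+ (t a ℤ.* P j b ℤ.+ t a ℤ.* term')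
      ≡⟨ cong (ℤ._+_ (S₅₀ (a * N))) (ℤP.*-distribˡ-+ (t a) (P j b) term') ⟨
    S₅₀ (a * N) ℤ.+ t a ℤ.* P j (suc b) ∎
  where
  open ≡-Reasoning
  N = 4 ^ k
  j = a % 5
  term  = if (b + a * N) % 5 ≡ᵇ 0 then t (b + a * N) else + 0
  term' = if (j + b) % 5 ≡ᵇ 0 then t b else + 0
  scale-if : ∀ (c : Bool) x y → (if c then x ℤ.* y else + 0) ≡ x ℤ.* (if c then y else + 0)
  scale-if true x y = refl
  scale-if false x y = sym (ℤP.*-zeroʳ x)
  term≡ : term ≡ t a ℤ.* term'
  term≡ = trans (cong₂ (λ c v → if c then v else + 0) (cong (_≡ᵇ 0) (mod5-shift N a b N≡1))
                       (trans (t-concat k a b b<N) (ℤP.*-comm (t b) (t a))))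
                (scale-if ((j + b) % 5 ≡ᵇ 0) (t a) (t b))

-- The combination G(a) = S₅₀(256a) − 10·S₅₀(16a) + 5·S₅₀(a), written with
-- the block sizes 4⁴, 4², 4⁰ so that each term obeys S₅₀-block.
G : ℕ → ℤ
G a = (S₅₀ (a * 4 ^ 4) ℤ.- (+ 10) ℤ.* S₅₀ (a * 4 ^ 2)) ℤ.+ (+ 5) ℤ.* S₅₀ (a * 4 ^ 0)

block-constant : ∀ j → j < 5 → (P j 256 ℤ.- (+ 10) ℤ.* P j 16) ℤ.+ (+ 5) ℤ.* P j 1 ≡ + 1
block-constant 0 _ = refl
block-constant 1 _ = refl
block-constant 2 _ = refl
block-constant 3 _ = refl
block-constant 4 _ = refl
block-constant (suc (suc (suc (suc (suc j))))) (s≤s (s≤s (s≤s (s≤s (s≤s ())))))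

-- Hence G has the same increments as T.
G≡T : ∀ a → G a ≡ T a
G≡T zero = refl
G≡T (suc a) = begin
    G (suc a)
      ≡⟨ cong₂ (λ x y → (x ℤ.- (+ 10) ℤ.* y) ℤ.+ (+ 5) ℤ.* S₅₀ (suc a * 1))
               (S₅₀-block 4 a 256 refl ≤-refl) (S₅₀-block 2 a 16 refl ≤-refl) ⟩
    ((S₅₀ (a * 256) ℤ.+ t a ℤ.* P j 256) ℤ.- (+ 10) ℤ.* (S₅₀ (a * 16) ℤ.+ t a ℤ.* P j 16))
      ℤ.+ (+ 5) ℤ.* S₅₀ (1 + a * 1)
      ≡⟨ cong (λ z → high ℤ.+ (+ 5) ℤ.* z) (S₅₀-block 0 a 1 refl ≤-refl) ⟩
    ((S₅₀ (a * 256) ℤ.+ t a ℤ.* P j 256) ℤ.- (+ 10) ℤ.* (S₅₀ (a * 16) ℤ.+ t a ℤ.* P j 16))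
      ℤ.+ (+ 5) ℤ.* (S₅₀ (a * 1) ℤ.+ t a ℤ.* P j 1)
      ≡⟨ collect (S₅₀ (a * 256)) (S₅₀ (a * 16)) (S₅₀ (a * 1)) (t a) (P j 256) (P j 16) (P j 1) ⟩
    G a ℤ.+ t a ℤ.* ((P j 256 ℤ.- (+ 10) ℤ.* P j 16) ℤ.+ (+ 5) ℤ.* P j 1)
      ≡⟨ cong₂ (λ x y → x ℤ.+ t a ℤ.* y) (G≡T a) (block-constant j (m%n<n a 5)) ⟩
    T a ℤ.+ t a ℤ.* + 1
      ≡⟨ cong (ℤ._+_ (T a)) (ℤP.*-identityʳ (t a)) ⟩
    T (suc a) ∎
  where
  open ≡-Reasoning
  j = a % 5
  high : ℤ
  high = (S₅₀ (a * 256) ℤ.+ t a ℤ.* P j 256) ℤ.- (+ 10) ℤ.* (S₅₀ (a * 16) ℤ.+ t a ℤ.* P j 16)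
  collect : ∀ X Y Z τ α β γ →
    ((X ℤ.+ τ ℤ.* α) ℤ.- (+ 10) ℤ.* (Y ℤ.+ τ ℤ.* β)) ℤ.+ (+ 5) ℤ.* (Z ℤ.+ τ ℤ.* γ)
    ≡ ((X ℤ.- (+ 10) ℤ.* Y) ℤ.+ (+ 5) ℤ.* Z) ℤ.+ τ ℤ.* ((α ℤ.- (+ 10) ℤ.* β) ℤ.+ (+ 5) ℤ.* γ)
  collect = ℤ-Solver.solve-∀

-- Closed form of u on the block of 256 starting at 256a: it depends only on
-- b, a mod 2 and a mod 5.
u-closed-form : ∀ a b → b < 256 → u (b + a * 256) ≡ t b ℤ.* (e a ℤ.+ P (a % 5) b)
u-closed-form a b b<256 = begin
    u x
      ≡⟨ cong (λ q → t x ℤ.* ((S₅₀ x ℤ.- (+ 10) ℤ.* S₅₀ (16 * q)) ℤ.+ (+ 5) ℤ.* S₅₀ q)) (div-low b a b<256) ⟩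
    t x ℤ.* ((S₅₀ x ℤ.- (+ 10) ℤ.* S₅₀ (16 * a)) ℤ.+ (+ 5) ℤ.* S₅₀ a)
      ≡⟨ cong₂ ℤ._*_ (t-concat 4 a b b<256) inner≡ ⟩
    (t b ℤ.* t a) ℤ.* (t a ℤ.* (e a ℤ.+ P j b))
      ≡⟨ regroup (t b) (t a) (e a ℤ.+ P j b) ⟩
    (t b ℤ.* (t a ℤ.* t a)) ℤ.* (e a ℤ.+ P j b)
      ≡⟨ cong (λ z → (t b ℤ.* z) ℤ.* (e a ℤ.+ P j b)) (sign-square (s₄ a)) ⟩
    (t b ℤ.* + 1) ℤ.* (e a ℤ.+ P j b)
      ≡⟨ cong (ℤ._* (e a ℤ.+ P j b)) (ℤP.*-identityʳ (t b)) ⟩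
    t b ℤ.* (e a ℤ.+ P j b) ∎
  where
  open ≡-Reasoning
  x = b + a * 256
  j = a % 5
  regroup : ∀ σ τ y → (σ ℤ.* τ) ℤ.* (τ ℤ.* y) ≡ (σ ℤ.* (τ ℤ.* τ)) ℤ.* y
  regroup = ℤ-Solver.solve-∀
  split-off : ∀ X Y Z τ p →
    ((X ℤ.+ τ ℤ.* p) ℤ.- (+ 10) ℤ.* Y) ℤ.+ (+ 5) ℤ.* Z ≡ ((X ℤ.- (+ 10) ℤ.* Y) ℤ.+ (+ 5) ℤ.* Z) ℤ.+ τ ℤ.* p
  split-off = ℤ-Solver.solve-∀
  inner≡ : (S₅₀ x ℤ.- (+ 10) ℤ.* S₅₀ (16 * a)) ℤ.+ (+ 5) ℤ.* S₅₀ a ≡ t a ℤ.* (e a ℤ.+ P j b)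
  inner≡ = begin
    (S₅₀ x ℤ.- (+ 10) ℤ.* S₅₀ (16 * a)) ℤ.+ (+ 5) ℤ.* S₅₀ a
      ≡⟨ cong₂ (λ y z → (y ℤ.- (+ 10) ℤ.* S₅₀ z) ℤ.+ (+ 5) ℤ.* S₅₀ a) (S₅₀-block 4 a b refl (<⇒≤ b<256)) (*-comm 16 a) ⟩
    ((S₅₀ (a * 256) ℤ.+ t a ℤ.* P j b) ℤ.- (+ 10) ℤ.* S₅₀ (a * 16)) ℤ.+ (+ 5) ℤ.* S₅₀ a
      ≡⟨ cong (λ z → ((S₅₀ (a * 256) ℤ.+ t a ℤ.* P j b) ℤ.- (+ 10) ℤ.* S₅₀ (a * 16)) ℤ.+ (+ 5) ℤ.* S₅₀ z) (*-identityʳ a) ⟨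
    ((S₅₀ (a * 256) ℤ.+ t a ℤ.* P j b) ℤ.- (+ 10) ℤ.* S₅₀ (a * 16)) ℤ.+ (+ 5) ℤ.* S₅₀ (a * 1)
      ≡⟨ split-off (S₅₀ (a * 256)) (S₅₀ (a * 16)) (S₅₀ (a * 1)) (t a) (P j b) ⟩
    G a ℤ.+ t a ℤ.* P j b
      ≡⟨ cong (ℤ._+ t a ℤ.* P j b) (trans (G≡T a) (T≡t*e a)) ⟩
    t a ℤ.* e a ℤ.+ t a ℤ.* P j b
      ≡⟨ ℤP.*-distribˡ-+ (t a) (e a) (P j b) ⟨
    t a ℤ.* (e a ℤ.+ P j b) ∎

-- Shifting x by 2560 = 10·256 shifts a by 10, which preserves a mod 2 and
-- a mod 5, so the closed form is unchanged.
mainTheorem12 : (x : ℕ) → u (x + 2560) ≡ u x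
mainTheorem12 x = begin
    u (x + 2560)                                 ≡⟨ cong (λ z → u (z + 2560)) x≡ ⟩
    u ((b + a * 256) + 2560)                     ≡⟨ cong u (shift b a) ⟩
    u (b + (10 + a) * 256)                       ≡⟨ u-closed-form (10 + a) b b<256 ⟩
    t b ℤ.* (e (10 + a) ℤ.+ P ((10 + a) % 5) b)  ≡⟨⟩
    t b ℤ.* (e a ℤ.+ P (a % 5) b)                ≡⟨ u-closed-form a b b<256 ⟨
    u (b + a * 256)                              ≡⟨ cong u x≡ ⟨
    u x                                          ∎
  where
  open ≡-Reasoning
  a = x / 256
  b = x % 256
  b<256 : b < 256
  b<256 = m%n<n x 256
  x≡ : x ≡ b + a * 256
  x≡ = m≡m%n+[m/n]*n x 256
  shift : ∀ b a → (b + a * 256) + 2560 ≡ b + (10 + a) * 256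
  shift = ℕ-Solver.solve-∀
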